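{- In any $\mathbf{QBDi3}$-model $\langle W,\le,D,V\rangle$, for every $w\in W$ and every sentence $A(\vec d)\in\mathsf{Sent}_{\mathbf D}$ with $\vec d\in D(w)$: (i) $1\in I(w,A(\vec d))$ iff $1\in I(w,f(A(\vec d)))$; (ii) $0\in I(w,A(\vec d))$ iff $1\in I(w,f({\sim}A(\vec d)))$.
   Context: $\mathcal{L}_Q$: first-order language with $\bot,{\sim},\land,\lor,\to,\forall,\exists$, a countable set $\mathsf{Con}$ of constants and predicate symbols; $\neg A:=A\to\bot$. A $\mathbf{QBDi3}$-model is $\langle W,\le,D,V\rangle$: $W$ a nonempty set; $\le$ a partial order on $W$ such that every $w$ has a maximal successor; $D(w)\supseteq\mathsf{Con}$ for each $w$, with $D(w)\subseteq D(x)$ when $w\le x$; for each $n$-ary predicate $P$ and $w$, sets $V^+(w,P),V^-(w,P)\subseteq D(w)^n$ with $V^+(w,P)\cap V^-(w,P)=\emptyset$, each monotone along $\le$, and potentially omniscient (for all $w$, $\vec d\in D(w)^n$ and $x\ge w$ there is $y\ge x$ with $\vec d\in V^+(y,P)\cup V^-(y,P)$). $\mathbf D=\bigcup_w D(w)$ and $\mathsf{Sent}_{\mathbf D}$ is the set of sentences with parameters from $\mathbf D$. $I(w,A)\subseteq\{0,1\}$: $1\in I(w,P(\vec d))$ iff $\vec d\in V^+(w,P)$; $0\in I(w,P(\vec d))$ iff $\vec d\in V^-(w,P)$; $1\notin I(w,\bot)$, $0\in I(w,\bot)$; $1\in I(w,{\sim}A)$ iff $0\in I(w,A)$; $0\in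 I(w,{\sim}A)$ iff $1\in I(w,A)$; $1\in I(w,A\land B)$ iff $1\in I(w,A)$ and $1\in I(w,B)$; $0\in I(w,A\land B)$ iff $0\in I(w,A)$ or $0\in I(w,B)$; $1\in I(w,A\lor B)$ iff $1\in I(w,A)$ or $1\in I(w,B)$; $0\in I(w,A\lor B)$ iff $0\in I(w,A)$ and $0\in I(w,B)$; $1\in I(w,A\to B)$ iff for all $x\ge w$, $1\notin I(x,A)$ or $1\in I(x,B)$; $0\in I(w,A\to B)$ iff ($0\notin I(x,A)$ for all $x\ge w$) and $0\in I(w,B)$; $1\in I(w,\forall xA)$ iff for all $x\ge w$ and $d\in D(x)$, $1\in I(x,A(d))$; $0\in I(w,\forall xA)$ iff $0\in I(w,A(d))$ for some $d\in D(w)$; $1\in I(w,\exists xA)$ iff $1\in I(w,A(d))$ for some $d\in D(w)$; $0\in I(w,\exists xA)$ iff for all $x\ge w$ and $d\in D(x)$, $0\in I(x,A(d))$. Reduction $f$: $f(P)=P$, $f({\sim}P)={\sim}P$ ($P$ atomic), $f(\bot)=\bot$, $f({\sim}\bot)={\sim}\bot$, $f(A\circ B)=f(A)\circ f(B)$ ($\circ\in\{\land,\lor,\to\}$), $f(QxA)=Qxf(A)$ ($Q\in\{\forall,\exists\}$), $f({\sim}{\sim}A)=f(A)$, $f({\sim}(A\land B))=f({\sim}A)\lor f({\sim}B)$, $f({\sim}(A\lor B))=f({\sim}A)\land f({\sim}B)$, $f({\sim}(A\to B))=\neg f({\sim}A)\land f({\sim}B)$, $f({\sim}\forall xA)=\exists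 xf({\sim}A)$, $f({\sim}\exists xA)=\forall xf({\sim}A)$. -}

module Defs where

open import Data.Nat using (ℕ; zero; suc; _⊔_)
open import Data.Fin using (Fin; zero; suc)
open import Data.Vec using (Vec; []; _∷_)
import Data.Vec as Vec
open import Data.Vec.Relation.Unary.All using (All)
open import Data.Product using (Σ; _×_; _,_)
open import Data.Sum using (_⊎_)
open import Data.Empty using (⊥)
open import Data.Unit using (⊤)
open import Relation.Nullary using (¬_)
open import Relation.Binary.PropositionalEquality using (_≡_)
open import Function.Definitions using (Injective)

record Language : Set₁ where
  field
    Con            : Set
    Pred           : Set
    arity          : Pred → ℕ
    Con-countable  : Σ (Con → ℕ) (λ g → Injective _≡_ _≡_ g)
    Pred-countable : Σ (Pred → ℕ) (λ g → Injective _≡_ _≡_ g)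

record Model (L : Language) : Set₁ where
  open Language L
  field
    W         : Set
    _≤_       : W → W → Set
    ≤-refl    : ∀ {w} → w ≤ w
    ≤-trans   : ∀ {w x y} → w ≤ x → x ≤ y → w ≤ y
    ≤-antisym : ∀ {w x} → w ≤ x → x ≤ w → w ≡ x
    maxSucc   : ∀ w → Σ W (λ m → w ≤ m × (∀ x → m ≤ x → x ≡ m))
    Dom       : Set
    D         : W → Dom → Set
    Dom-union : ∀ d → Σ W (λ w → D w d)
    ι         : Con → Dom
    ι-inj     : Injective _≡_ _≡_ ι
    Con⊆D     : ∀ w c → D w (ι c)
    D-mono    : ∀ {w x} → w ≤ x → ∀ d → D w d → D x d
    V⁺ V⁻     : W → (P : Pred) → Vec Dom (arity P) → Set
    V⁺⊆D      : ∀ w P ds → V⁺ w P ds → All (D w) ds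
    V⁻⊆D      : ∀ w P ds → V⁻ w P ds → All (D w) ds
    V-disj    : ∀ w P ds → V⁺ w P ds → V⁻ w P ds → ⊥
    V⁺-mono   : ∀ {w x} → w ≤ x → ∀ P ds → V⁺ w P ds → V⁺ x P ds
    V⁻-mono   : ∀ {w x} → w ≤ x → ∀ P ds → V⁻ w P ds → V⁻ x P ds
    pot-omni  : ∀ w P ds → All (D w) ds → ∀ x → w ≤ x →
                Σ W (λ y → x ≤ y × (V⁺ y P ds ⊎ V⁻ y P ds))

-- Syntax: formulas with n free (de Bruijn) variables, constants and
-- parameters from a set Par.  Sentences with parameters = Fm 0.

module Syntax (L : Language) (Par : Set) where
  open Language L

  data Term (n : ℕ) : Set where
    var : Fin n → Term n
    con : Con → Term n
    par : Par → Term n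

  infix  6 ∼_
  infixr 5 _∧'_
  infixr 4 _∨'_
  infixr 3 _⇒_

  data Fm (n : ℕ) : Set where
    atom       : (P : Pred) → Vec (Term n) (arity P) → Fm n
    ⊥'         : Fm n
    ∼_         : Fm n → Fm n
    _∧'_ _∨'_ _⇒_ : Fm n → Fm n → Fm n
    ∀' ∃'      : Fm (suc n) → Fm n

  ¬'_ : ∀ {n} → Fm n → Fm n
  ¬' A = A ⇒ ⊥'

  wkT : ∀ {n} → Term n → Term (suc n)
  wkT (var i) = var (suc i)
  wkT (con c) = con c
  wkT (par d) = par d

  lift : ∀ {m n} → (Fin m → Term n) → Fin (suc m) → Term (suc n)
  lift σ zero    = var zero
  lift σ (suc i) = wkT (σ i)

  substT : ∀ {m n} → (Fin m → Term n) → Term m → Term n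
  substT σ (var i) = σ i
  substT σ (con c) = con c
  substT σ (par d) = par d

  substTs : ∀ {m n k} → (Fin m → Term n) → Vec (Term m) k → Vec (Term n) k
  substTs σ []       = []
  substTs σ (t ∷ ts) = substT σ t ∷ substTs σ ts

  subst : ∀ {m n} → (Fin m → Term n) → Fm m → Fm n
  subst σ (atom P ts) = atom P (substTs σ ts)
  subst σ ⊥'          = ⊥'
  subst σ (∼ A)       = ∼ subst σ A
  subst σ (A ∧' B)    = subst σ A ∧' subst σ B
  subst σ (A ∨' B)    = subst σ A ∨' subst σ B
  subst σ (A ⇒ B)     = subst σ A ⇒ subst σ B
  subst σ (∀' A)      = ∀' (subst (lift σ) A)
  subst σ (∃' A)      = ∃' (subst (lift σ) A)

  -- A(d): replace the variable bound by the outermost binder by parameter d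
  inst₀ : ∀ {n} → Par → Fin (suc n) → Term n
  inst₀ d zero    = par d
  inst₀ d (suc i) = var i

  _[_] : ∀ {n} → Fm (suc n) → Par → Fm n
  A [ d ] = subst (inst₀ d) A

  -- depth (used as the recursion measure for the valuation)
  depth : ∀ {n} → Fm n → ℕ
  depth (atom P ts) = 0
  depth ⊥'          = 0
  depth (∼ A)       = suc (depth A)
  depth (A ∧' B)    = suc (depth A ⊔ depth B)
  depth (A ∨' B)    = suc (depth A ⊔ depth B)
  depth (A ⇒ B)     = suc (depth A ⊔ depth B)
  depth (∀' A)      = suc (depth A)
  depth (∃' A)      = suc (depth A)

  ParsT : ∀ {n} → (Par → Set) → Term n → Set
  ParsT Q (var i) = ⊤
  ParsT Q (con c) = ⊤
  ParsT Q (par d) = Q d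

  ParsIn : ∀ {n} → (Par → Set) → Fm n → Set
  ParsIn Q (atom P ts) = All (ParsT Q) ts
  ParsIn Q ⊥'          = ⊤
  ParsIn Q (∼ A)       = ParsIn Q A
  ParsIn Q (A ∧' B)    = ParsIn Q A × ParsIn Q B
  ParsIn Q (A ∨' B)    = ParsIn Q A × ParsIn Q B
  ParsIn Q (A ⇒ B)     = ParsIn Q A × ParsIn Q B
  ParsIn Q (∀' A)      = ParsIn Q A
  ParsIn Q (∃' A)      = ParsIn Q A

  -- The reduction f.  fneg A stands for f(∼A) (mutual definition so that
  -- the recursion is structural); f (∼ A) = fneg A definitionally.
  mutual
    f : ∀ {n} → Fm n → Fm n
    f (atom P ts) = atom P ts
    f ⊥'          = ⊥'
    f (∼ A)       = fneg A
    f (A ∧' B)    = f A ∧' f B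
    f (A ∨' B)    = f A ∨' f B
    f (A ⇒ B)     = f A ⇒ f B
    f (∀' A)      = ∀' (f A)
    f (∃' A)      = ∃' (f A)

    fneg : ∀ {n} → Fm n → Fm n
    fneg (atom P ts) = ∼ atom P ts
    fneg ⊥'          = ∼ ⊥'
    fneg (∼ A)       = f A
    fneg (A ∧' B)    = fneg A ∨' fneg B
    fneg (A ∨' B)    = fneg A ∧' fneg B
    fneg (A ⇒ B)     = (¬' fneg A) ∧' fneg B
    fneg (∀' A)      = ∃' (fneg A)
    fneg (∃' A)      = ∀' (fneg A)

-- Tr k w A  means 1 ∈ I(w,A), Fa k w A means 0 ∈ I(w,A), computed with
-- fuel k; the official interpretation uses fuel = depth A (which is
-- enough, since A(d) has the same depth as A).

module Semantics {L : Language} (M : Model L) where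
  open Language L
  open Model M
  open Syntax L Dom public

  ⟦_⟧ : Term 0 → Dom
  ⟦ var () ⟧
  ⟦ con c ⟧ = ι c
  ⟦ par d ⟧ = d

  mutual
    Tr : ℕ → W → Fm 0 → Set
    Tr k       w (atom P ts) = V⁺ w P (Vec.map ⟦_⟧ ts)
    Tr k       w ⊥'          = ⊥
    Tr zero    w _           = ⊥
    Tr (suc k) w (∼ A)       = Fa k w A
    Tr (suc k) w (A ∧' B)    = Tr k w A × Tr k w B
    Tr (suc k) w (A ∨' B)    = Tr k w A ⊎ Tr k w B
    Tr (suc k) w (A ⇒ B)     = ∀ x → w ≤ x → ¬ Tr k x A ⊎ Tr k x B
    Tr (suc k) w (∀' A)      = ∀ x → w ≤ x → ∀ d → D x d → Tr k x (A [ d ])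
    Tr (suc k) w (∃' A)      = Σ Dom (λ d → D w d × Tr k w (A [ d ]))

    Fa : ℕ → W → Fm 0 → Set
    Fa k       w (atom P ts) = V⁻ w P (Vec.map ⟦_⟧ ts)
    Fa k       w ⊥'          = ⊤
    Fa zero    w _           = ⊥
    Fa (suc k) w (∼ A)       = Tr k w A
    Fa (suc k) w (A ∧' B)    = Fa k w A ⊎ Fa k w B
    Fa (suc k) w (A ∨' B)    = Fa k w A × Fa k w B
    Fa (suc k) w (A ⇒ B)     = (∀ x → w ≤ x → ¬ Fa k x A) × Fa k w B
    Fa (suc k) w (∀' A)      = Σ Dom (λ d → D w d × Fa k w (A [ d ]))
    Fa (suc k) w (∃' A)      = ∀ x → w ≤ x → ∀ d → D x d → Fa k x (A [ d ])

  I1 : W → Fm 0 → Set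
  I1 w A = Tr (depth A) w A

  I0 : W → Fm 0 → Set
  I0 w A = Fa (depth A) w A

Sent : {L : Language} → Model L → Set
Sent {L} M = Syntax.Fm L (Model.Dom M) 0

-- The reduction f pushes strong negation ∼ inwards using exactly the
-- clauses that define falsity: 0 ∈ I(w, A) unfolds along the structure of
-- A in the same way as 1 ∈ I(w, f(∼A)) does along the structure of f(∼A).
-- The only clause that is not literally mirrored is implication, where
-- 0 ∈ I(w, A → B) demands that A is refuted nowhere above w; this is
-- 1 ∈ I(w, ¬ f(∼A)) because ⊥ is never true.  Since f commutes with
-- instantiating a bound variable, both statements follow by one
-- simultaneous induction.
module Submission where

open import Defs
open import Data.Nat using (zero; suc; _≤_; s≤s; s≤s⁻¹; _⊔_)
open import Data.Nat.Properties using (≤-refl; m⊔n≤o⇒m≤o; m⊔n≤o⇒n≤o)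
open import Data.Fin using (Fin)
open import Data.Product using (Σ; _×_; _,_)
open import Data.Product.Function.NonDependent.Propositional using (_×-⇔_)
open import Data.Sum using (inj₁; [_,_]′)
open import Data.Sum.Function.Propositional using (_⊎-⇔_)
open import Data.Empty using (⊥-elim)
open import Function using (id; _∘_)
open import Function.Bundles using (_⇔_; mk⇔; Equivalence)
open import Function.Construct.Composition using (_⇔-∘_)
open import Function.Construct.Identity using (⇔-id)
open import Function.Construct.Symmetry using (⇔-sym)
open import Function.Related.TypeIsomorphisms using (¬-cong-⇔)
open import Relation.Binary.PropositionalEquality using (_≡_; refl; cong; cong₂; sym)
import Relation.Binary.PropositionalEquality as ≡
open import Relation.Nullary using (¬_)

Π-cong-⇔ : {A : Set} {P Q : A → Set} → (∀ x → P x ⇔ Q x) → (∀ x → P x) ⇔ (∀ x → Q x)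
Π-cong-⇔ P⇔Q = mk⇔ (λ p x → Equivalence.to (P⇔Q x) (p x)) (λ q x → Equivalence.from (P⇔Q x) (q x))

Σ-cong-⇔ : {A : Set} {P Q : A → Set} → (∀ x → P x ⇔ Q x) → Σ A P ⇔ Σ A Q
Σ-cong-⇔ P⇔Q = mk⇔ (λ (x , p) → x , Equivalence.to (P⇔Q x) p) (λ (x , q) → x , Equivalence.from (P⇔Q x) q)

module SyntaxProperties (L : Language) (Par : Set) where
  open Syntax L Par

  mutual
    f-subst : ∀ {m n} (σ : Fin m → Term n) (A : Fm m) → f (subst σ A) ≡ subst σ (f A)
    f-subst σ (atom P ts) = refl
    f-subst σ ⊥'          = refl
    f-subst σ (∼ A)       = fneg-subst σ A
    f-subst σ (A ∧' B)    = cong₂ _∧'_ (f-subst σ A) (f-subst σ B)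
    f-subst σ (A ∨' B)    = cong₂ _∨'_ (f-subst σ A) (f-subst σ B)
    f-subst σ (A ⇒ B)     = cong₂ _⇒_ (f-subst σ A) (f-subst σ B)
    f-subst σ (∀' A)      = cong ∀' (f-subst (lift σ) A)
    f-subst σ (∃' A)      = cong ∃' (f-subst (lift σ) A)

    fneg-subst : ∀ {m n} (σ : Fin m → Term n) (A : Fm m) → fneg (subst σ A) ≡ subst σ (fneg A)
    fneg-subst σ (atom P ts) = refl
    fneg-subst σ ⊥'          = refl
    fneg-subst σ (∼ A)       = f-subst σ A
    fneg-subst σ (A ∧' B)    = cong₂ _∨'_ (fneg-subst σ A) (fneg-subst σ B)
    fneg-subst σ (A ∨' B)    = cong₂ _∧'_ (fneg-subst σ A) (fneg-subst σ B)
    fneg-subst σ (A ⇒ B)     = cong₂ (λ X Y → ¬' X ∧' Y) (fneg-subst σ A) (fneg-subst σ B)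
    fneg-subst σ (∀' A)      = cong ∃' (fneg-subst (lift σ) A)
    fneg-subst σ (∃' A)      = cong ∀' (fneg-subst (lift σ) A)

  depth-subst : ∀ {m n} (σ : Fin m → Term n) (A : Fm m) → depth (subst σ A) ≡ depth A
  depth-subst σ (atom P ts) = refl
  depth-subst σ ⊥'          = refl
  depth-subst σ (∼ A)       = cong suc (depth-subst σ A)
  depth-subst σ (A ∧' B)    = cong suc (cong₂ _⊔_ (depth-subst σ A) (depth-subst σ B))
  depth-subst σ (A ∨' B)    = cong suc (cong₂ _⊔_ (depth-subst σ A) (depth-subst σ B))
  depth-subst σ (A ⇒ B)     = cong suc (cong₂ _⊔_ (depth-subst σ A) (depth-subst σ B))
  depth-subst σ (∀' A)      = cong suc (depth-subst (lift σ) A)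
  depth-subst σ (∃' A)      = cong suc (depth-subst (lift σ) A)

  depth-[] : ∀ {k} (A : Fm 1) d → depth A ≤ k → depth (A [ d ]) ≤ k
  depth-[] A d = ≡.subst (_≤ _) (sym (depth-subst (inst₀ d) A))

  depth-f-[] : ∀ {k} (A : Fm 1) d → depth (f A) ≤ k → depth (f (A [ d ])) ≤ k
  depth-f-[] A d = ≡.subst (λ B → depth B ≤ _) (sym (f-subst (inst₀ d) A)) ∘ depth-[] (f A) d

  depth-fneg-[] : ∀ {k} (A : Fm 1) d → depth (fneg A) ≤ k → depth (fneg (A [ d ])) ≤ k
  depth-fneg-[] A d = ≡.subst (λ B → depth B ≤ _) (sym (fneg-subst (inst₀ d) A)) ∘ depth-[] (fneg A) d

module ReductionSoundness {L : Language} (M : Model L) where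
  open Model M using (Dom) renaming (_≤_ to _≼_)
  open Semantics M
  open SyntaxProperties L Dom

  Tr-¬' : ∀ {k} (A : Fm 0) w → Tr (suc k) w (¬' A) ⇔ (∀ x → w ≼ x → ¬ Tr k x A)
  Tr-¬' A w = mk⇔ (λ h x w≼x → [ id , ⊥-elim ]′ (h x w≼x)) (λ h x w≼x → inj₁ (h x w≼x))

  -- Two separate fuels are needed because f can increase depth.
  mutual
    Tr⇔Tr-f : ∀ {k₁ k₂} (A : Fm 0) w → depth A ≤ k₁ → depth (f A) ≤ k₂ →
              Tr k₁ w A ⇔ Tr k₂ w (f A)
    Tr⇔Tr-f (atom P ts) w _       _       = ⇔-id _
    Tr⇔Tr-f ⊥'          w _       _       = ⇔-id _
    Tr⇔Tr-f (∼ A)       w (s≤s p) q       = Fa⇔Tr-fneg A w p q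
    Tr⇔Tr-f (A ∧' B)    w (s≤s p) (s≤s q) =
      Tr⇔Tr-f A w (m⊔n≤o⇒m≤o _ _ p) (m⊔n≤o⇒m≤o _ _ q) ×-⇔ Tr⇔Tr-f B w (m⊔n≤o⇒n≤o _ _ p) (m⊔n≤o⇒n≤o _ _ q)
    Tr⇔Tr-f (A ∨' B)    w (s≤s p) (s≤s q) =
      Tr⇔Tr-f A w (m⊔n≤o⇒m≤o _ _ p) (m⊔n≤o⇒m≤o _ _ q) ⊎-⇔ Tr⇔Tr-f B w (m⊔n≤o⇒n≤o _ _ p) (m⊔n≤o⇒n≤o _ _ q)
    Tr⇔Tr-f (A ⇒ B)     w (s≤s p) (s≤s q) = Π-cong-⇔ λ x → Π-cong-⇔ λ _ →
      ¬-cong-⇔ (Tr⇔Tr-f A x (m⊔n≤o⇒m≤o _ _ p) (m⊔n≤o⇒m≤o _ _ q)) ⊎-⇔ Tr⇔Tr-f B x (m⊔n≤o⇒n≤o _ _ p) (m⊔n≤o⇒n≤o _ _ q)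
    Tr⇔Tr-f (∀' A)      w (s≤s p) (s≤s q) =
      Π-cong-⇔ λ x → Π-cong-⇔ λ _ → Π-cong-⇔ λ d → Π-cong-⇔ λ _ → Tr⇔Tr-f-[] A d x p q
    Tr⇔Tr-f (∃' A)      w (s≤s p) (s≤s q) =
      Σ-cong-⇔ λ d → ⇔-id _ ×-⇔ Tr⇔Tr-f-[] A d w p q

    Fa⇔Tr-fneg : ∀ {k₁ k₂} (A : Fm 0) w → depth A ≤ k₁ → depth (fneg A) ≤ k₂ →
                 Fa k₁ w A ⇔ Tr k₂ w (fneg A)
    Fa⇔Tr-fneg (atom P ts) w _       (s≤s _) = ⇔-id _
    Fa⇔Tr-fneg ⊥'          w _       (s≤s _) = ⇔-id _
    Fa⇔Tr-fneg (∼ A)       w (s≤s p) q       = Tr⇔Tr-f A w p q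
    Fa⇔Tr-fneg (A ∧' B)    w (s≤s p) (s≤s q) =
      Fa⇔Tr-fneg A w (m⊔n≤o⇒m≤o _ _ p) (m⊔n≤o⇒m≤o _ _ q) ⊎-⇔ Fa⇔Tr-fneg B w (m⊔n≤o⇒n≤o _ _ p) (m⊔n≤o⇒n≤o _ _ q)
    Fa⇔Tr-fneg (A ∨' B)    w (s≤s p) (s≤s q) =
      Fa⇔Tr-fneg A w (m⊔n≤o⇒m≤o _ _ p) (m⊔n≤o⇒m≤o _ _ q) ×-⇔ Fa⇔Tr-fneg B w (m⊔n≤o⇒n≤o _ _ p) (m⊔n≤o⇒n≤o _ _ q)
    Fa⇔Tr-fneg {k₂ = suc zero} (A ⇒ B) w _ (s≤s q) with m⊔n≤o⇒m≤o (depth (¬' fneg A)) (depth (fneg B)) q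
    ... | ()
    Fa⇔Tr-fneg {suc k₁} {suc (suc k)} (A ⇒ B) w (s≤s p) (s≤s q) =
      (⇔-sym (Tr-¬' (fneg A) w) ⇔-∘ refuted-nowhere) ×-⇔ Fa⇔Tr-fneg B w (m⊔n≤o⇒n≤o _ _ p) (m⊔n≤o⇒n≤o _ _ q)
      where
      refuted-nowhere : (∀ x → w ≼ x → ¬ Fa k₁ x A) ⇔ (∀ x → w ≼ x → ¬ Tr k x (fneg A))
      refuted-nowhere = Π-cong-⇔ λ x → Π-cong-⇔ λ _ →
        ¬-cong-⇔ (Fa⇔Tr-fneg A x (m⊔n≤o⇒m≤o _ _ p) (m⊔n≤o⇒m≤o (depth (fneg A)) 0
          (s≤s⁻¹ (m⊔n≤o⇒m≤o (depth (¬' fneg A)) (depth (fneg B)) q))))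
    Fa⇔Tr-fneg (∀' A)      w (s≤s p) (s≤s q) =
      Σ-cong-⇔ λ d → ⇔-id _ ×-⇔ Fa⇔Tr-fneg-[] A d w p q
    Fa⇔Tr-fneg (∃' A)      w (s≤s p) (s≤s q) =
      Π-cong-⇔ λ x → Π-cong-⇔ λ _ → Π-cong-⇔ λ d → Π-cong-⇔ λ _ → Fa⇔Tr-fneg-[] A d x p q

    Tr⇔Tr-f-[] : ∀ {k₁ k₂} (A : Fm 1) d w → depth A ≤ k₁ → depth (f A) ≤ k₂ →
                 Tr k₁ w (A [ d ]) ⇔ Tr k₂ w (f A [ d ])
    Tr⇔Tr-f-[] {k₁} {k₂} A d w p q = ≡.subst (λ B → Tr k₁ w (A [ d ]) ⇔ Tr k₂ w B) (f-subst (inst₀ d) A)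
      (Tr⇔Tr-f (A [ d ]) w (depth-[] A d p) (depth-f-[] A d q))

    Fa⇔Tr-fneg-[] : ∀ {k₁ k₂} (A : Fm 1) d w → depth A ≤ k₁ → depth (fneg A) ≤ k₂ →
                    Fa k₁ w (A [ d ]) ⇔ Tr k₂ w (fneg A [ d ])
    Fa⇔Tr-fneg-[] {k₁} {k₂} A d w p q = ≡.subst (λ B → Fa k₁ w (A [ d ]) ⇔ Tr k₂ w B) (fneg-subst (inst₀ d) A)
      (Fa⇔Tr-fneg (A [ d ]) w (depth-[] A d p) (depth-fneg-[] A d q))

lemma3p7 : (L : Language) (M : Model L) (w : Model.W M) (A : Sent M) →
    Semantics.ParsIn M (Model.D M w) A →
    (Semantics.I1 M w A ⇔ Semantics.I1 M w (Semantics.f M A))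
    × (Semantics.I0 M w A ⇔ Semantics.I1 M w (Semantics.f M (Syntax.∼_ {L} {Model.Dom M} A)))
lemma3p7 L M w A _ = Tr⇔Tr-f A w ≤-refl ≤-refl , Fa⇔Tr-fneg A w ≤-refl ≤-refl
  where open ReductionSoundness M
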